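{- The largest number of vertices of an oriented clique whose underlying graph has maximum degree at most $3$ is $7$.
   Context: An oriented graph is an orientation of a simple undirected graph (its underlying graph); degrees are taken in the underlying graph. An oriented $k$-colouring of an oriented graph $G$ is a map $c:V(G)\to\{0,\dots,k-1\}$ such that $c(u)\neq c(v)$ for every arc $uv$, and for all arcs $uv, xy$, if $c(u)=c(y)$ then $c(v)\neq c(x)$. The oriented chromatic number $\chi_o(G)$ is the least $k$ for which an oriented $k$-colouring exists. An oriented clique is an oriented graph $G$ with $\chi_o(G)=|V(G)|$. -}

module Defs where

open import Data.Nat using (ℕ; _≤_; _<_)
open import Data.Fin using (Fin)
open import Data.Bool using (Bool; true; false; _∨_)
open import Data.List using (length; filter; allFin)
open import Data.Product using (_×_; Σ)
open import Relation.Binary.PropositionalEquality using (_≡_; _≢_)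
open import Relation.Nullary using (¬_)
open import Data.Bool.Properties using (T?)
open import Data.Bool using (T)

record OrientedGraph (n : ℕ) : Set where
  field
    arc        : Fin n → Fin n → Bool
    irreflexive : ∀ u → arc u u ≡ false
    antisym    : ∀ u v → arc u v ≡ true → arc v u ≡ false
open OrientedGraph public

adjacent : ∀ {n} → OrientedGraph n → Fin n → Fin n → Bool
adjacent G u v = arc G u v ∨ arc G v u

degree : ∀ {n} → OrientedGraph n → Fin n → ℕ
degree {n} G u = length (filter (λ v → T? (adjacent G u v)) (allFin n))

MaxDegreeAtMost : ∀ {n} → OrientedGraph n → ℕ → Set
MaxDegreeAtMost G d = ∀ u → degree G u ≤ d

IsOrientedColouring : ∀ {n} → OrientedGraph n → (k : ℕ) → (Fin n → Fin k) → Set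
IsOrientedColouring G k c =
  (∀ u v → arc G u v ≡ true → c u ≢ c v) ×
  (∀ u v x y → arc G u v ≡ true → arc G x y ≡ true → c u ≡ c y → c v ≢ c x)

OrientedColourable : ∀ {n} → OrientedGraph n → ℕ → Set
OrientedColourable {n} G k = Σ (Fin n → Fin k) (IsOrientedColouring G k)

OrientedChromaticNumber : ∀ {n} → OrientedGraph n → ℕ → Set
OrientedChromaticNumber G k = OrientedColourable G k × (∀ j → j < k → ¬ OrientedColourable G j)

OrientedClique : ∀ {n} → OrientedGraph n → Set
OrientedClique {n} G = OrientedChromaticNumber G n

-- In an oriented clique any two distinct vertices u, x are linked: adjacent, or joined by a
-- directed 2-path; otherwise giving u and x the same colour (and every other vertex its own)
-- would be an oriented colouring with fewer colours.  Count the arcs and 2-paths between all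
-- ordered pairs: a vertex w accounts for d⁺(w) + d⁻(w) + 2 d⁻(w) d⁺(w) ≤ 7 of them when its
-- degree is at most 3, while linkedness demands at least n (n - 1).  Hence n ≤ 8, and for n = 8
-- every inequality is tight: each vertex has in- and out-degree 1 and 2 in some order, and
-- each pair is linked exactly once.  Relabelling, and reversing all arcs if necessary, gives
-- the arcs 0 → 1, 0 → 2, 3 → 0, and an exhaustive search over the orientations of the remaining
-- pairs, pruned by these constraints, finds no such graph.  An explicit oriented graph on 7
-- vertices attains the bound.
module Submission where

open import Defs
open import Data.Bool using (Bool; true; false; _∧_; _∨_; not; T)
open import Data.Bool.Properties using (T?; T-∧; T-∨; T-≡; not-¬; ∧-comm; ∧-conicalˡ; ∧-conicalʳ)
import Data.Bool.Properties as Bool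
open import Data.Empty using (⊥; ⊥-elim)
open import Data.Fin using (Fin; zero; suc; punchIn; punchOut)
open import Data.Fin.Patterns
open import Data.Fin.Permutation as Perm using (Permutation; _⟨$⟩ʳ_; _⟨$⟩ˡ_; _∘ₚ_; transpose; inverseʳ; inverseˡ)
import Data.Fin.Permutation.Components as PC
open import Data.Fin.Properties using (_≟_; any?; all?; pigeonhole; <⇒≢; punchInᵢ≢i; punchOut-injective; suc-injective)
open import Data.List using (List; []; _∷_; length; filter; tabulate)
open import Data.Maybe using (Maybe; just; nothing)
open import Data.Maybe.Relation.Unary.All using (All; just; nothing)
import Data.Nat as ℕ
open ℕ using (ℕ; zero; suc; pred; _+_; _*_; _≤_; _≤?_; _≤ᵇ_; z≤n; s≤s)
open import Data.Nat.Properties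
  using (≤-refl; ≤-reflexive; ≤-trans; ≤-antisym; ≤-pred; ≤∧≢⇒<; n<1+n; m≤m+n; m≤n+m; ≤⇒≤ᵇ; +-identityʳ; *-identityʳ;
         +-mono-≤; +-monoˡ-≤; +-monoʳ-≤; +-cancelˡ-≤; +-cancelʳ-≤; *-cancelˡ-≤; +-0-commutativeMonoid; +-*-semiring;
         module ≤-Reasoning)
import Data.Product
open Data.Product using (_×_; _,_; Σ; ∃)
import Data.Sum
open Data.Sum using (_⊎_; inj₁; inj₂)
open import Data.Vec using (Vec; lookup; replicate; _[_]≔_; _[_]%=_)
import Data.Vec as Vec
open import Data.Vec.Properties using (lookup∘tabulate; lookup-replicate; lookup∘update; lookup∘update′; lookup∘updateAt; lookup∘updateAt′)
import Data.Vec.Functional as Vector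
open import Function using (_∘_; id; flip; Equivalence)
open import Relation.Binary.PropositionalEquality
open import Relation.Nullary using (¬_; Dec; yes; no; does)
open import Relation.Nullary.Decidable using (dec-true; dec-false; decidable-stable; toWitness; ¬?; _×-dec_; _→-dec_)
open Equivalence using (to; from)
-- Sums are taken in the monoid (ℕ, +, 0) rather than in the semiring ℕ: they evaluate several
-- times faster, which matters for the search below, and the semiring lemmas still apply.
open import Algebra.Properties.CommutativeMonoid.Sum +-0-commutativeMonoid
  using (sum; sum-cong-≗; ∑-distrib-+; ∑-comm; sum-remove; sum-permute)
open import Algebra.Properties.Semiring.Sum +-*-semiring using (*-distribˡ-sum; *-distribʳ-sum)

⟦_⟧ : Bool → ℕ
⟦ true ⟧ = 1
⟦ false ⟧ = 0

count : ∀ {n} → (Fin n → Bool) → ℕ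
count p = sum (⟦_⟧ ∘ p)

sum-const : ∀ n {c} → sum {n} (λ _ → c) ≡ n * c
sum-const zero = refl
sum-const (suc n) = cong (_ +_) (sum-const n)

sum-mono-≤ : ∀ {n} {f g : Fin n → ℕ} → (∀ i → f i ≤ g i) → sum f ≤ sum g
sum-mono-≤ {zero} _ = z≤n
sum-mono-≤ {suc n} f≤g = +-mono-≤ (f≤g zero) (sum-mono-≤ (f≤g ∘ suc))

≤-sum : ∀ {n} (f : Fin n → ℕ) i → f i ≤ sum f
≤-sum {suc n} f i = subst (f i ≤_) (sym (sum-remove {i = i} f)) (m≤m+n (f i) _)

sum-tight : ∀ {n} {f g : Fin n → ℕ} → (∀ i → f i ≤ g i) → sum g ≤ sum f → ∀ i → f i ≡ g i
sum-tight {suc n} {f} {g} f≤g Σg≤Σf zero = ≤-antisym (f≤g zero)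
  (+-cancelʳ-≤ (sum (g ∘ suc)) (g zero) (f zero)
    (≤-trans Σg≤Σf (+-monoʳ-≤ (f zero) (sum-mono-≤ (f≤g ∘ suc)))))
sum-tight {suc n} {f} {g} f≤g Σg≤Σf (suc i) = sum-tight (f≤g ∘ suc)
  (+-cancelˡ-≤ (f zero) _ _ (≤-trans (+-monoˡ-≤ (sum (g ∘ suc)) (f≤g zero)) Σg≤Σf)) i

count≥1⇒∃ : ∀ {n} (p : Fin n → Bool) → 1 ≤ count p → ∃ λ a → p a ≡ true
count≥1⇒∃ {suc n} p h with p zero in eq
... | true = zero , eq
... | false = let a , pa = count≥1⇒∃ (p ∘ suc) h in suc a , pa

count≥2⇒∃₂ : ∀ {n} (p : Fin n → Bool) → 2 ≤ count p →
             Σ (Fin n) λ a → Σ (Fin n) λ b → a ≢ b × p a ≡ true × p b ≡ true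
count≥2⇒∃₂ {suc n} p h with p zero in eq
... | true = let b , pb = count≥1⇒∃ (p ∘ suc) (≤-pred h) in zero , suc b , (λ ()) , eq , pb
... | false = let a , b , a≢b , pa , pb = count≥2⇒∃₂ (p ∘ suc) h in
  suc a , suc b , a≢b ∘ suc-injective , pa , pb

length-filter-tabulate : ∀ {a} {A : Set a} {n} (p : A → Bool) (h : Fin n → A) →
                         length (filter (T? ∘ p) (tabulate h)) ≡ count (p ∘ h)
length-filter-tabulate {n = zero} p h = refl
length-filter-tabulate {n = suc n} p h with p (h zero)
... | true = cong suc (length-filter-tabulate p (h ∘ suc))
... | false = length-filter-tabulate p (h ∘ suc)

⟦⟧-mono : ∀ {a b} → (T a → T b) → ⟦ a ⟧ ≤ ⟦ b ⟧
⟦⟧-mono {false} _ = z≤n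
⟦⟧-mono {true} {true} _ = ≤-refl
⟦⟧-mono {true} {false} a⇒b = ⊥-elim (a⇒b _)

∧-mono : ∀ {a b c d} → (T a → T c) → (T b → T d) → T (a ∧ b) → T (c ∧ d)
∧-mono a⇒c b⇒d a∧b = from T-∧ (Data.Product.map a⇒c b⇒d (to T-∧ a∧b))

∨-mono : ∀ {a b c d} → (T a → T c) → (T b → T d) → T (a ∨ b) → T (c ∨ d)
∨-mono a⇒c b⇒d a∨b = from T-∨ (Data.Sum.map a⇒c b⇒d (to T-∨ a∨b))

T-foldr-∧ : ∀ {n} {p : Fin n → Bool} → (∀ i → T (p i)) → T (Vector.foldr _∧_ true p)
T-foldr-∧ {zero} _ = _
T-foldr-∧ {suc n} holds = from T-∧ (holds zero , T-foldr-∧ (holds ∘ suc))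

⟦∧⟧ : ∀ a b → ⟦ a ∧ b ⟧ ≡ ⟦ a ⟧ * ⟦ b ⟧
⟦∧⟧ true b = sym (+-identityʳ ⟦ b ⟧)
⟦∧⟧ false b = refl

∑∑-distrib-+ : ∀ {m n} (f g : Fin m → Fin n → ℕ) →
               sum (λ i → sum (λ j → f i j + g i j)) ≡ sum (λ i → sum (f i)) + sum (λ i → sum (g i))
∑∑-distrib-+ f g = trans (sum-cong-≗ λ i → ∑-distrib-+ (f i) (g i)) (∑-distrib-+ (λ i → sum (f i)) (λ i → sum (g i)))

module _ {n : ℕ} (R : Fin n → Fin n → Bool) where

  outDegree inDegree adjDegree : Fin n → ℕ
  outDegree v = count (R v)
  inDegree v = count (λ w → R w v)
  adjDegree v = count (λ w → R v w ∨ R w v)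

  twoPathsVia : Fin n → Fin n → Fin n → ℕ
  twoPathsVia u x w = ⟦ R u w ∧ R w x ⟧ + ⟦ R x w ∧ R w u ⟧

  linkCount : Fin n → Fin n → ℕ
  linkCount u x = ⟦ R u x ⟧ + ⟦ R x u ⟧ + sum (twoPathsVia u x)

_⊆_ : ∀ {n} → (R S : Fin n → Fin n → Bool) → Set
R ⊆ S = ∀ i j → T (R i j) → T (S i j)

module _ {n : ℕ} {R S : Fin n → Fin n → Bool} (R⊆S : R ⊆ S) where

  outDegree-mono : ∀ v → outDegree R v ≤ outDegree S v
  outDegree-mono v = sum-mono-≤ λ w → ⟦⟧-mono (R⊆S v w)

  inDegree-mono : ∀ v → inDegree R v ≤ inDegree S v
  inDegree-mono v = sum-mono-≤ λ w → ⟦⟧-mono (R⊆S w v)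

  adjDegree-mono : ∀ v → adjDegree R v ≤ adjDegree S v
  adjDegree-mono v = sum-mono-≤ λ w → ⟦⟧-mono (∨-mono (R⊆S v w) (R⊆S w v))

  linkCount-mono : ∀ u x → linkCount R u x ≤ linkCount S u x
  linkCount-mono u x = +-mono-≤ (+-mono-≤ (⟦⟧-mono (R⊆S u x)) (⟦⟧-mono (R⊆S x u)))
    (sum-mono-≤ λ w → +-mono-≤ (⟦⟧-mono (∧-mono (R⊆S u w) (R⊆S w x)))
                               (⟦⟧-mono (∧-mono (R⊆S x w) (R⊆S w u))))

module _ {n : ℕ} (R : Fin n → Fin n → Bool) where

  ∑twoPaths≡∑in*out : sum (λ u → sum (λ x → sum (λ w → ⟦ R u w ∧ R w x ⟧))) ≡ sum (λ w → inDegree R w * outDegree R w)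
  ∑twoPaths≡∑in*out = begin
    sum (λ u → sum (λ x → sum (λ w → ⟦ R u w ∧ R w x ⟧))) ≡⟨ sum-cong-≗ (λ u → ∑-comm λ x w → ⟦ R u w ∧ R w x ⟧) ⟩
    sum (λ u → sum (λ w → sum (λ x → ⟦ R u w ∧ R w x ⟧))) ≡⟨ sum-cong-≗ (λ u → sum-cong-≗ λ w → pull u w) ⟩
    sum (λ u → sum (λ w → ⟦ R u w ⟧ * outDegree R w))    ≡⟨ ∑-comm (λ u w → ⟦ R u w ⟧ * outDegree R w) ⟩
    sum (λ w → sum (λ u → ⟦ R u w ⟧ * outDegree R w))    ≡⟨ sum-cong-≗ (λ w → *-distribʳ-sum (outDegree R w) (λ u → ⟦ R u w ⟧)) ⟨
    sum (λ w → inDegree R w * outDegree R w)              ∎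
    where
    open ≡-Reasoning
    pull : ∀ u w → sum (λ x → ⟦ R u w ∧ R w x ⟧) ≡ ⟦ R u w ⟧ * outDegree R w
    pull u w = trans (sum-cong-≗ λ x → ⟦∧⟧ (R u w) (R w x)) (sym (*-distribˡ-sum ⟦ R u w ⟧ (⟦_⟧ ∘ R w)))

  -- Vertex w is charged for its out- and in-arcs and, twice, for the directed 2-paths through it.
  linkShare : Fin n → ℕ
  linkShare w = outDegree R w + inDegree R w + 2 * (inDegree R w * outDegree R w)

  ∑linkCount≡∑linkShare : sum (λ u → sum (linkCount R u)) ≡ sum linkShare
  ∑linkCount≡∑linkShare = begin
    sum (λ u → sum (linkCount R u))
      ≡⟨ ∑∑-distrib-+ (λ u x → ⟦ R u x ⟧ + ⟦ R x u ⟧) (λ u x → sum (twoPathsVia R u x)) ⟩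
    sum (λ u → sum (λ x → ⟦ R u x ⟧ + ⟦ R x u ⟧)) + sum (λ u → sum (λ x → sum (twoPathsVia R u x)))
      ≡⟨ cong₂ _+_ (sum-cong-≗ λ u → ∑-distrib-+ (⟦_⟧ ∘ R u) (λ x → ⟦ R x u ⟧)) ∑∑∑twoPathsVia ⟩
    sum (λ w → outDegree R w + inDegree R w) + 2 * sum twoPathsThrough
      ≡⟨ cong (sum (λ w → outDegree R w + inDegree R w) +_) (*-distribˡ-sum 2 twoPathsThrough) ⟩
    sum (λ w → outDegree R w + inDegree R w) + sum (λ w → 2 * twoPathsThrough w)
      ≡⟨ ∑-distrib-+ (λ w → outDegree R w + inDegree R w) (λ w → 2 * twoPathsThrough w) ⟨
    sum linkShare ∎
    where
    open ≡-Reasoning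
    twoPathsThrough : Fin n → ℕ
    twoPathsThrough w = inDegree R w * outDegree R w
    ∑∑∑twoPathsVia : sum (λ u → sum (λ x → sum (twoPathsVia R u x))) ≡ 2 * sum twoPathsThrough
    ∑∑∑twoPathsVia = begin
      sum (λ u → sum (λ x → sum (twoPathsVia R u x)))
        ≡⟨ sum-cong-≗ (λ u → sum-cong-≗ λ x → ∑-distrib-+ (λ w → ⟦ R u w ∧ R w x ⟧) (λ w → ⟦ R x w ∧ R w u ⟧)) ⟩
      sum (λ u → sum (λ x → sum (λ w → ⟦ R u w ∧ R w x ⟧) + sum (λ w → ⟦ R x w ∧ R w u ⟧)))
        ≡⟨ ∑∑-distrib-+ (λ u x → sum (λ w → ⟦ R u w ∧ R w x ⟧)) (λ u x → sum (λ w → ⟦ R x w ∧ R w u ⟧)) ⟩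
      sum (λ u → sum (λ x → sum (λ w → ⟦ R u w ∧ R w x ⟧))) + sum (λ u → sum (λ x → sum (λ w → ⟦ R x w ∧ R w u ⟧)))
        ≡⟨ cong (sum (λ u → sum (λ x → sum (λ w → ⟦ R u w ∧ R w x ⟧))) +_) (∑-comm λ u x → sum (λ w → ⟦ R x w ∧ R w u ⟧)) ⟩
      sum (λ u → sum (λ x → sum (λ w → ⟦ R u w ∧ R w x ⟧))) + sum (λ x → sum (λ u → sum (λ w → ⟦ R x w ∧ R w u ⟧)))
        ≡⟨ cong₂ _+_ ∑twoPaths≡∑in*out ∑twoPaths≡∑in*out ⟩
      sum twoPathsThrough + sum twoPathsThrough
        ≡⟨ cong (sum twoPathsThrough +_) (+-identityʳ (sum twoPathsThrough)) ⟨
      2 * sum twoPathsThrough ∎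

loop-free : ∀ {n} (G : OrientedGraph n) {v} → arc G v v ≢ true
loop-free G {v} h with () ← trans (sym h) (irreflexive G v)

digon-free : ∀ {n} (G : OrientedGraph n) {u v} → arc G u v ≡ true → arc G v u ≢ true
digon-free G {u} {v} uv vu with () ← trans (sym vu) (antisym G u v uv)

arc⇒≢ : ∀ {n} (G : OrientedGraph n) {u v} → arc G u v ≡ true → u ≢ v
arc⇒≢ G uv refl = loop-free G uv

module _ {n : ℕ} (G : OrientedGraph n) where

  ⟦adjacent⟧ : ∀ u v → ⟦ adjacent G u v ⟧ ≡ ⟦ arc G u v ⟧ + ⟦ arc G v u ⟧
  ⟦adjacent⟧ u v with arc G u v in uv
  ... | false = refl
  ... | true rewrite antisym G u v uv = refl

  adjDegree≡out+in : ∀ v → adjDegree (arc G) v ≡ outDegree (arc G) v + inDegree (arc G) v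
  adjDegree≡out+in v = trans (sum-cong-≗ (⟦adjacent⟧ v)) (∑-distrib-+ (⟦_⟧ ∘ arc G v) (λ w → ⟦ arc G w v ⟧))

  degree≡out+in : ∀ v → degree G v ≡ outDegree (arc G) v + inDegree (arc G) v
  degree≡out+in v = trans (length-filter-tabulate (adjacent G v) id) (adjDegree≡out+in v)

module _ {n : ℕ} (G : OrientedGraph n) where

  data Linked (u x : Fin n) : Set where
    arc⟶ : arc G u x ≡ true → Linked u x
    arc⟵ : arc G x u ≡ true → Linked u x
    path⟶ : ∀ w → arc G u w ≡ true → arc G w x ≡ true → Linked u x
    path⟵ : ∀ w → arc G x w ≡ true → arc G w u ≡ true → Linked u x

  AllLinked : Set
  AllLinked = ∀ u x → u ≢ x → Linked u x

  dipath? : ∀ u x → Dec (∃ λ w → arc G u w ≡ true × arc G w x ≡ true)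
  dipath? u x = any? λ w → (arc G u w Bool.≟ true) ×-dec (arc G w x Bool.≟ true)

  linked? : ∀ u x → Dec (Linked u x)
  linked? u x with arc G u x in ux | arc G x u in xu | dipath? u x | dipath? x u
  ... | true  | _    | _                  | _                  = yes (arc⟶ ux)
  ... | false | true | _                  | _                  = yes (arc⟵ xu)
  ... | false | false | yes (w , uw , wx) | _                  = yes (path⟶ w uw wx)
  ... | false | false | no _             | yes (w , xw , wu) = yes (path⟵ w xw wu)
  ... | false | false | no ¬uwx           | no ¬xwu           = no λ where
    (arc⟶ h) → not-¬ ux h
    (arc⟵ h) → not-¬ xu h
    (path⟶ w uw wx) → ¬uwx (w , uw , wx)
    (path⟵ w xw wu) → ¬xwu (w , xw , wu)

  linked⇒linkCount≥1 : ∀ {u x} → Linked u x → 1 ≤ linkCount (arc G) u x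
  linked⇒linkCount≥1 (arc⟶ ux) rewrite ux = s≤s z≤n
  linked⇒linkCount≥1 {u} {x} (arc⟵ xu) rewrite xu = ≤-trans (m≤n+m 1 ⟦ arc G u x ⟧) (m≤m+n _ (sum (twoPathsVia (arc G) u x)))
  linked⇒linkCount≥1 {u} {x} (path⟶ w uw wx) = begin
    1                              ≡⟨ cong₂ (λ a b → ⟦ a ∧ b ⟧) uw wx ⟨
    ⟦ arc G u w ∧ arc G w x ⟧      ≤⟨ m≤m+n _ _ ⟩
    twoPathsVia (arc G) u x w      ≤⟨ ≤-sum (twoPathsVia (arc G) u x) w ⟩
    sum (twoPathsVia (arc G) u x)  ≤⟨ m≤n+m _ _ ⟩
    linkCount (arc G) u x          ∎
    where open ≤-Reasoning
  linked⇒linkCount≥1 {u} {x} (path⟵ w xw wu) = begin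
    1                              ≡⟨ cong₂ (λ a b → ⟦ a ∧ b ⟧) xw wu ⟨
    ⟦ arc G x w ∧ arc G w u ⟧      ≤⟨ m≤n+m _ _ ⟩
    twoPathsVia (arc G) u x w      ≤⟨ ≤-sum (twoPathsVia (arc G) u x) w ⟩
    sum (twoPathsVia (arc G) u x)  ≤⟨ m≤n+m _ _ ⟩
    linkCount (arc G) u x          ∎
    where open ≤-Reasoning

  linked⇒distinctColours : ∀ {k c} → IsOrientedColouring G k c → ∀ {u x} → Linked u x → c u ≢ c x
  linked⇒distinctColours (proper , _) (arc⟶ ux) = proper _ _ ux
  linked⇒distinctColours (proper , _) (arc⟵ xu) = proper _ _ xu ∘ sym
  linked⇒distinctColours (_ , oriented) (path⟶ w uw wx) cu≡cx = oriented _ _ _ _ uw wx cu≡cx refl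
  linked⇒distinctColours (_ , oriented) (path⟵ w xw wu) cu≡cx = oriented _ _ _ _ xw wu (sym cu≡cx) refl

  identityColouring : OrientedColourable G n
  identityColouring = id , (λ u v → arc⇒≢ G) , λ { u v x y uv xy refl refl → digon-free G uv xy }

  allLinked⇒clique : AllLinked → OrientedClique G
  allLinked⇒clique linked = identityColouring , λ j j<n (c , colouring) →
    let i , k , i<k , ci≡ck = pigeonhole j<n c
    in  linked⇒distinctColours colouring (linked i k (<⇒≢ i<k)) ci≡ck

module Identify {m : ℕ} (G : OrientedGraph (suc m)) {u x : Fin (suc m)} (u≢x : u ≢ x) (unlinked : ¬ Linked G u x) where

  merge : Fin (suc m) → Fin (suc m)
  merge y with y ≟ x
  ... | yes _ = u
  ... | no _ = y

  x≢merge : ∀ y → x ≢ merge y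
  x≢merge y with y ≟ x
  ... | yes _ = u≢x ∘ sym
  ... | no y≢x = y≢x ∘ sym

  colour : Fin (suc m) → Fin m
  colour y = punchOut (x≢merge y)

  data SameColour : Fin (suc m) → Fin (suc m) → Set where
    same : ∀ {y} → SameColour y y
    x~u : SameColour x u
    u~x : SameColour u x

  sameColour : ∀ y z → colour y ≡ colour z → SameColour y z
  sameColour y z cy≡cz with y ≟ x | z ≟ x | punchOut-injective (x≢merge y) (x≢merge z) cy≡cz
  ... | yes refl | yes refl | _    = same
  ... | yes refl | no _     | refl = x~u
  ... | no _     | yes refl | refl = u~x
  ... | no _     | no _     | refl = same

  isColouring : IsOrientedColouring G m colour
  isColouring = proper , oriented
    where
    proper : ∀ a b → arc G a b ≡ true → colour a ≢ colour b
    proper a b ab ca≡cb with sameColour a b ca≡cb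
    ... | same = loop-free G ab
    ... | x~u = unlinked (arc⟵ ab)
    ... | u~x = unlinked (arc⟶ ab)

    oriented : ∀ a b p q → arc G a b ≡ true → arc G p q ≡ true → colour a ≡ colour q → colour b ≢ colour p
    oriented a b p q ab pq ca≡cq cb≡cp with sameColour a q ca≡cq | sameColour b p cb≡cp
    ... | same | same = digon-free G ab pq
    ... | same | x~u = unlinked (path⟶ a pq ab)
    ... | same | u~x = unlinked (path⟵ a pq ab)
    ... | x~u  | same = unlinked (path⟵ b ab pq)
    ... | u~x  | same = unlinked (path⟶ b ab pq)
    ... | x~u  | x~u = loop-free G ab
    ... | x~u  | u~x = unlinked (arc⟵ ab)
    ... | u~x  | x~u = unlinked (arc⟶ ab)
    ... | u~x  | u~x = loop-free G ab

clique⇒allLinked : ∀ {n} (G : OrientedGraph n) → OrientedClique G → AllLinked G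
clique⇒allLinked {suc m} G (_ , minimal) u x u≢x = decidable-stable (linked? G u x)
  λ unlinked → minimal m (n<1+n m) (_ , Identify.isColouring G u≢x unlinked)

-- The counting bound

InOut12 : ℕ → ℕ → Set
InOut12 i o = (i ≡ 1 × o ≡ 2) ⊎ (i ≡ 2 × o ≡ 1)

linkShare-bound : ∀ o i → o + i ≤ 3 → o + i + 2 * (i * o) ≤ 7
linkShare-bound 0 0 _ = z≤n
linkShare-bound 0 1 _ = s≤s z≤n
linkShare-bound 0 2 _ = s≤s (s≤s z≤n)
linkShare-bound 0 3 _ = s≤s (s≤s (s≤s z≤n))
linkShare-bound 1 0 _ = s≤s z≤n
linkShare-bound 1 1 _ = s≤s (s≤s (s≤s (s≤s z≤n)))
linkShare-bound 1 2 _ = ≤-refl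
linkShare-bound 2 0 _ = s≤s (s≤s z≤n)
linkShare-bound 2 1 _ = ≤-refl
linkShare-bound 3 0 _ = s≤s (s≤s (s≤s z≤n))
linkShare-bound (suc (suc (suc (suc _)))) _ (s≤s (s≤s (s≤s ())))
linkShare-bound 0 (suc (suc (suc (suc _)))) (s≤s (s≤s (s≤s ())))
linkShare-bound 1 (suc (suc (suc _))) (s≤s (s≤s (s≤s ())))
linkShare-bound 2 (suc (suc _)) (s≤s (s≤s (s≤s ())))
linkShare-bound 3 (suc _) (s≤s (s≤s (s≤s ())))

linkShare-tight : ∀ o i → o + i ≤ 3 → o + i + 2 * (i * o) ≡ 7 → InOut12 i o
linkShare-tight 1 2 _ _ = inj₂ (refl , refl)
linkShare-tight 2 1 _ _ = inj₁ (refl , refl)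
linkShare-tight 0 0 _ ()
linkShare-tight 0 1 _ ()
linkShare-tight 0 2 _ ()
linkShare-tight 0 3 _ ()
linkShare-tight 1 0 _ ()
linkShare-tight 1 1 _ ()
linkShare-tight 2 0 _ ()
linkShare-tight 3 0 _ ()
linkShare-tight (suc (suc (suc (suc _)))) _ (s≤s (s≤s (s≤s ()))) _
linkShare-tight 0 (suc (suc (suc (suc _)))) (s≤s (s≤s (s≤s ()))) _
linkShare-tight 1 (suc (suc (suc _))) (s≤s (s≤s (s≤s ()))) _
linkShare-tight 2 (suc (suc _)) (s≤s (s≤s (s≤s ()))) _
linkShare-tight 3 (suc _) (s≤s (s≤s (s≤s ()))) _

offDiagonal : ∀ {n} → Fin n → Fin n → ℕ
offDiagonal u x = ⟦ not (does (u ≟ x)) ⟧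

sum-offDiagonal : ∀ {n} (u : Fin n) → sum (offDiagonal u) ≡ pred n
sum-offDiagonal {suc m} u = begin
  sum (offDiagonal u)                                 ≡⟨ sum-remove {i = u} (offDiagonal u) ⟩
  offDiagonal u u + sum (offDiagonal u ∘ punchIn u)    ≡⟨ cong₂ _+_ diagonal (sum-cong-≗ offDiagonal-punchIn) ⟩
  sum {m} (λ _ → 1)                                   ≡⟨ sum-const m ⟩
  m * 1                                               ≡⟨ *-identityʳ m ⟩
  m                                                   ∎
  where
  open ≡-Reasoning
  diagonal : offDiagonal u u ≡ 0
  diagonal = cong (⟦_⟧ ∘ not) (dec-true (u ≟ u) refl)
  offDiagonal-punchIn : ∀ j → offDiagonal u (punchIn u j) ≡ 1
  offDiagonal-punchIn j = cong (⟦_⟧ ∘ not) (dec-false (u ≟ punchIn u j) (punchInᵢ≢i u j ∘ sym))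

∑offDiagonal : ∀ n → sum (λ (u : Fin n) → sum (offDiagonal u)) ≡ n * pred n
∑offDiagonal n = trans (sum-cong-≗ (sum-offDiagonal {n})) (sum-const n)

n*pred[n]≤n*7⇒n≤8 : ∀ n → n * pred n ≤ n * 7 → n ≤ 8
n*pred[n]≤n*7⇒n≤8 zero _ = z≤n
n*pred[n]≤n*7⇒n≤8 (suc m) h = s≤s (*-cancelˡ-≤ (suc m) h)

record Extremal {n : ℕ} (G : OrientedGraph n) : Set where
  field
    split : ∀ v → InOut12 (inDegree (arc G) v) (outDegree (arc G) v)
    uniquelyLinked : ∀ u x → u ≢ x → linkCount (arc G) u x ≡ 1

  outDegree≤2 : ∀ v → outDegree (arc G) v ≤ 2
  outDegree≤2 v with split v
  ... | inj₁ (_ , out≡2) = ≤-reflexive out≡2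
  ... | inj₂ (_ , out≡1) = ≤-trans (≤-reflexive out≡1) (s≤s z≤n)

  inDegree≤2 : ∀ v → inDegree (arc G) v ≤ 2
  inDegree≤2 v with split v
  ... | inj₁ (in≡1 , _) = ≤-trans (≤-reflexive in≡1) (s≤s z≤n)
  ... | inj₂ (in≡2 , _) = ≤-reflexive in≡2

  out+in≡3 : ∀ v → outDegree (arc G) v + inDegree (arc G) v ≡ 3
  out+in≡3 v with split v
  ... | inj₁ (in≡1 , out≡2) = cong₂ _+_ out≡2 in≡1
  ... | inj₂ (in≡2 , out≡1) = cong₂ _+_ out≡1 in≡2

module _ {n : ℕ} (G : OrientedGraph n) (linked : AllLinked G) (subcubic : MaxDegreeAtMost G 3) where

  private
    ∑linkCount : ℕ
    ∑linkCount = sum (λ u → sum (linkCount (arc G) u))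

  linkShare≤7 : ∀ w → linkShare (arc G) w ≤ 7
  linkShare≤7 w = linkShare-bound (outDegree (arc G) w) (inDegree (arc G) w) (subst (_≤ 3) (degree≡out+in G w) (subcubic w))

  offDiagonal≤linkCount : ∀ u x → offDiagonal u x ≤ linkCount (arc G) u x
  offDiagonal≤linkCount u x with u ≟ x
  ... | yes _ = z≤n
  ... | no u≢x = linked⇒linkCount≥1 G (linked u x u≢x)

  n*pred[n]≤∑linkCount : n * pred n ≤ ∑linkCount
  n*pred[n]≤∑linkCount = subst (_≤ ∑linkCount) (∑offDiagonal n)
    (sum-mono-≤ λ u → sum-mono-≤ (offDiagonal≤linkCount u))

  ∑linkCount≤n*7 : ∑linkCount ≤ n * 7
  ∑linkCount≤n*7 = subst₂ _≤_ (sym (∑linkCount≡∑linkShare (arc G))) (sum-const n) (sum-mono-≤ linkShare≤7)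

  size≤8 : n ≤ 8
  size≤8 = n*pred[n]≤n*7⇒n≤8 n (≤-trans n*pred[n]≤∑linkCount ∑linkCount≤n*7)

  -- For n = 8 both estimates of ∑linkCount are equalities, hence so is every term in them.
  extremal : n ≡ 8 → Extremal G
  extremal refl = record { split = split ; uniquelyLinked = uniquelyLinked }
    where
    linkShare≡7 : ∀ w → linkShare (arc G) w ≡ 7
    linkShare≡7 = sum-tight linkShare≤7 (subst (56 ≤_) (∑linkCount≡∑linkShare (arc G)) n*pred[n]≤∑linkCount)

    split : ∀ v → InOut12 (inDegree (arc G) v) (outDegree (arc G) v)
    split v = linkShare-tight (outDegree (arc G) v) (inDegree (arc G) v) (subst (_≤ 3) (degree≡out+in G v) (subcubic v)) (linkShare≡7 v)

    rowSums : ∀ u → sum (offDiagonal u) ≡ sum (linkCount (arc G) u)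
    rowSums = sum-tight (λ u → sum-mono-≤ (offDiagonal≤linkCount u))
                        (subst (∑linkCount ≤_) (sym (∑offDiagonal 8)) ∑linkCount≤n*7)

    uniquelyLinked : ∀ u x → u ≢ x → linkCount (arc G) u x ≡ 1
    uniquelyLinked u x u≢x = begin
      linkCount (arc G) u x ≡⟨ sum-tight (offDiagonal≤linkCount u) (≤-reflexive (sym (rowSums u))) x ⟨
      offDiagonal u x       ≡⟨ cong (⟦_⟧ ∘ not) (dec-false (u ≟ x) u≢x) ⟩
      1                     ∎
      where open ≡-Reasoning

relabel : ∀ {n} → Permutation n n → OrientedGraph n → OrientedGraph n
relabel π G = record
  { arc = λ x y → arc G (π ⟨$⟩ʳ x) (π ⟨$⟩ʳ y)
  ; irreflexive = λ u → irreflexive G (π ⟨$⟩ʳ u)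
  ; antisym = λ u v → antisym G (π ⟨$⟩ʳ u) (π ⟨$⟩ʳ v)
  }

converse : ∀ {n} → OrientedGraph n → OrientedGraph n
converse G = record
  { arc = flip (arc G)
  ; irreflexive = irreflexive G
  ; antisym = flip (antisym G)
  }

module _ {n : ℕ} (π : Permutation n n) (R : Fin n → Fin n → Bool) where
  private
    σ = π ⟨$⟩ʳ_
    Rσ : Fin n → Fin n → Bool
    Rσ x y = R (σ x) (σ y)

  sum-relabel : ∀ (f : Fin n → ℕ) → sum (f ∘ σ) ≡ sum f
  sum-relabel f = sym (sum-permute f π)

  outDegree-relabel : ∀ v → outDegree Rσ v ≡ outDegree R (σ v)
  outDegree-relabel v = sum-relabel (⟦_⟧ ∘ R (σ v))

  inDegree-relabel : ∀ v → inDegree Rσ v ≡ inDegree R (σ v)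
  inDegree-relabel v = sum-relabel (λ w → ⟦ R w (σ v) ⟧)

  linkCount-relabel : ∀ u x → linkCount Rσ u x ≡ linkCount R (σ u) (σ x)
  linkCount-relabel u x = cong (⟦ R (σ u) (σ x) ⟧ + ⟦ R (σ x) (σ u) ⟧ +_) (sum-relabel (twoPathsVia R (σ u) (σ x)))

linkCount-flip : ∀ {n} (R : Fin n → Fin n → Bool) u x → linkCount (flip R) u x ≡ linkCount R x u
linkCount-flip R u x = cong (⟦ R x u ⟧ + ⟦ R u x ⟧ +_) (sum-cong-≗ λ w →
  cong₂ _+_ (cong ⟦_⟧ (∧-comm (R w u) (R x w))) (cong ⟦_⟧ (∧-comm (R w x) (R u w))))

permutation-injective : ∀ {n} (π : Permutation n n) {u x} → π ⟨$⟩ʳ u ≡ π ⟨$⟩ʳ x → u ≡ x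
permutation-injective π e = trans (sym (inverseˡ π)) (trans (cong (π ⟨$⟩ˡ_) e) (inverseˡ π))

relabel-extremal : ∀ {n} (π : Permutation n n) {G : OrientedGraph n} → Extremal G → Extremal (relabel π G)
relabel-extremal π {G} ext = record
  { split = λ v → subst₂ InOut12 (sym (inDegree-relabel π (arc G) v)) (sym (outDegree-relabel π (arc G) v)) (split (π ⟨$⟩ʳ v))
  ; uniquelyLinked = λ u x u≢x → trans (linkCount-relabel π (arc G) u x) (uniquelyLinked _ _ (u≢x ∘ permutation-injective π))
  }
  where open Extremal ext

converse-extremal : ∀ {n} {G : OrientedGraph n} → Extremal G → Extremal (converse G)
converse-extremal {G = G} ext = record
  { split = λ v → swap (split v)
  ; uniquelyLinked = λ u x u≢x → trans (linkCount-flip (arc G) u x) (uniquelyLinked x u (u≢x ∘ sym))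
  }
  where
  open Extremal ext
  swap : ∀ {i o} → InOut12 i o → InOut12 o i
  swap (inj₁ (i≡1 , o≡2)) = inj₂ (o≡2 , i≡1)
  swap (inj₂ (i≡2 , o≡1)) = inj₁ (o≡1 , i≡2)

transpose-matchˡ : ∀ {n} (i j : Fin n) → PC.transpose i j i ≡ j
transpose-matchˡ i j rewrite dec-true (i ≟ i) refl = refl

transpose-fixes : ∀ {n} {i j k : Fin n} → k ≢ i → k ≢ j → PC.transpose i j k ≡ k
transpose-fixes {i = i} {j} {k} k≢i k≢j rewrite dec-false (k ≟ i) k≢i | dec-false (k ≟ j) k≢j = refl

redirect : ∀ {n} (σ : Permutation n n) (t y : Fin n) →
           Σ (Permutation n n) λ σ′ → σ′ ⟨$⟩ʳ t ≡ y × (∀ k → k ≢ t → σ ⟨$⟩ʳ k ≢ y → σ′ ⟨$⟩ʳ k ≡ σ ⟨$⟩ʳ k)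
redirect σ t y = transpose t s ∘ₚ σ , trans (cong (σ ⟨$⟩ʳ_) (transpose-matchˡ t s)) (inverseʳ σ) ,
  λ k k≢t σk≢y → cong (σ ⟨$⟩ʳ_) (transpose-fixes k≢t λ k≡s → σk≢y (trans (cong (σ ⟨$⟩ʳ_) k≡s) (inverseʳ σ)))
  where s = σ ⟨$⟩ˡ y

placing : ∀ {m} (a b c : Fin (4 + m)) → 0F ≢ a → 0F ≢ b → 0F ≢ c → a ≢ b → a ≢ c → b ≢ c →
          Σ (Permutation (4 + m) (4 + m)) λ σ →
            σ ⟨$⟩ʳ 0F ≡ 0F × σ ⟨$⟩ʳ 1F ≡ a × σ ⟨$⟩ʳ 2F ≡ b × σ ⟨$⟩ʳ 3F ≡ c
placing a b c 0≢a 0≢b 0≢c a≢b a≢c b≢c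
  with redirect Perm.id 1F a
... | σ₁ , σ₁1≡a , keep₁
  with redirect σ₁ 2F b
... | σ₂ , σ₂2≡b , keep₂
  with redirect σ₂ 3F c
... | σ₃ , σ₃3≡c , keep₃ = σ₃ , σ₃0≡0 , σ₃1≡a , σ₃2≡b , σ₃3≡c
  where
  σ₁0≡0 : σ₁ ⟨$⟩ʳ 0F ≡ 0F
  σ₁0≡0 = keep₁ 0F (λ ()) 0≢a
  σ₂0≡0 : σ₂ ⟨$⟩ʳ 0F ≡ 0F
  σ₂0≡0 = trans (keep₂ 0F (λ ()) (0≢b ∘ trans (sym σ₁0≡0))) σ₁0≡0
  σ₂1≡a : σ₂ ⟨$⟩ʳ 1F ≡ a
  σ₂1≡a = trans (keep₂ 1F (λ ()) (a≢b ∘ trans (sym σ₁1≡a))) σ₁1≡a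
  σ₃0≡0 : σ₃ ⟨$⟩ʳ 0F ≡ 0F
  σ₃0≡0 = trans (keep₃ 0F (λ ()) (0≢c ∘ trans (sym σ₂0≡0))) σ₂0≡0
  σ₃1≡a : σ₃ ⟨$⟩ʳ 1F ≡ a
  σ₃1≡a = trans (keep₃ 1F (λ ()) (a≢c ∘ trans (sym σ₂1≡a))) σ₂1≡a
  σ₃2≡b : σ₃ ⟨$⟩ʳ 2F ≡ b
  σ₃2≡b = trans (keep₃ 2F (λ ()) (b≢c ∘ trans (sym σ₂2≡b))) σ₂2≡b

-- Exhaustive search on eight vertices

-- A table records what is known of an orientation of the complete graph on Fin 8:
-- just true for an arc, just false for a non-arc, nothing when undecided.
Table : Set
Table = Vec (Vec (Maybe Bool) 8) 8

entry : Table → Fin 8 → Fin 8 → Maybe Bool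
entry P i j = lookup (lookup P i) j

record _⊑_ (P : Table) (G : OrientedGraph 8) : Set where
  field agrees : ∀ i j → All (arc G i j ≡_) (entry P i j)
open _⊑_

set : Table → Fin 8 → Fin 8 → Maybe Bool → Table
set P i j e = P [ i ]%= (_[ j ]≔ e)

set-⊑ : ∀ {P G i j e} → P ⊑ G → All (arc G i j ≡_) e → set P i j e ⊑ G
set-⊑ {P} {G} {i} {j} {e} P⊑G ok .agrees x y with x ≟ i | y ≟ j
... | yes refl | yes refl = subst (All _) (sym same) ok
  where same : entry (set P x y e) x y ≡ e
        same = trans (cong (λ r → lookup r y) (lookup∘updateAt x P)) (lookup∘update y (lookup P x) e)
... | yes refl | no y≢j = subst (All _) (sym sameRow) (agrees P⊑G x y)
  where sameRow : entry (set P x j e) x y ≡ entry P x y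
        sameRow = trans (cong (λ r → lookup r y) (lookup∘updateAt x P)) (lookup∘update′ y≢j (lookup P x) e)
... | no x≢i | _ = subst (All _) (sym otherRow) (agrees P⊑G x y)
  where otherRow : entry (set P i j e) x y ≡ entry P x y
        otherRow = cong (λ r → lookup r y) (lookup∘updateAt′ x i x≢i P)

orient : Table → Fin 8 → Fin 8 → Bool → Bool → Table
orient P i j a b = set (set P i j (just a)) j i (just b)

orient-⊑ : ∀ {P G i j a b} → P ⊑ G → arc G i j ≡ a → arc G j i ≡ b → orient P i j a b ⊑ G
orient-⊑ P⊑G ij ji = set-⊑ (set-⊑ P⊑G (just ij)) (just ji)

emptyTable : Table
emptyTable = Vec.tabulate λ i → replicate 8 nothing [ i ]≔ just false

emptyTable-⊑ : ∀ G → emptyTable ⊑ G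
emptyTable-⊑ G .agrees i j with j ≟ i
... | yes refl = subst (All _) (sym diagonal) (just (irreflexive G i))
  where diagonal : entry emptyTable i i ≡ just false
        diagonal = trans (cong (λ r → lookup r i) (lookup∘tabulate (λ k → replicate 8 nothing [ k ]≔ just false) i)) (lookup∘update i (replicate 8 nothing) (just false))
... | no j≢i = subst (All _) (sym offDiagonalEntry) nothing
  where offDiagonalEntry : entry emptyTable i j ≡ nothing
        offDiagonalEntry = trans (cong (λ r → lookup r j) (lookup∘tabulate (λ k → replicate 8 nothing [ k ]≔ just false) i))
                                 (trans (lookup∘update′ j≢i (replicate 8 nothing) (just false)) (lookup-replicate j nothing))

surely possibly : Maybe Bool → Bool
surely (just b) = b
surely nothing = false
possibly (just b) = b
possibly nothing = true

Sure Possible : Table → Fin 8 → Fin 8 → Bool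
Sure P i j = surely (entry P i j)
Possible P i j = possibly (entry P i j)

vertexOK : Table → Fin 8 → Bool
vertexOK P v = (outDegree (Sure P) v ≤ᵇ 2) ∧ (inDegree (Sure P) v ≤ᵇ 2)
             ∧ (outDegree (Sure P) v + inDegree (Sure P) v ≤ᵇ 3) ∧ (3 ≤ᵇ adjDegree (Possible P) v)

pairOK : Table → Fin 8 → Fin 8 → Bool
pairOK P x y = does (x ≟ y) ∨ ((linkCount (Sure P) x y ≤ᵇ 1) ∧ (1 ≤ᵇ linkCount (Possible P) x y))

consistent : Table → Fin 8 → Fin 8 → Bool
consistent P i j = vertexOK P i ∧ vertexOK P j ∧ Vector.foldr _∧_ true (λ y → pairOK P i y ∧ pairOK P j y)

refute : Table → List (Fin 8 × Fin 8) → Bool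
closes : Table → Fin 8 → Fin 8 → List (Fin 8 × Fin 8) → Bool
refute P [] = false
refute P ((i , j) ∷ ps) = closes (orient P i j false false) i j ps ∧ closes (orient P i j true false) i j ps ∧ closes (orient P i j false true) i j ps
closes Q i j ps = not (consistent Q i j) ∨ refute Q ps

module _ {P : Table} {G : OrientedGraph 8} (P⊑G : P ⊑ G) where

  Sure⊆arc : Sure P ⊆ arc G
  Sure⊆arc i j with entry P i j | agrees P⊑G i j
  ... | just true | just ij = λ _ → subst T (sym ij) _
  ... | just false | _ = λ ()
  ... | nothing | _ = λ ()

  arc⊆Possible : arc G ⊆ Possible P
  arc⊆Possible i j with entry P i j | agrees P⊑G i j
  ... | just true | _ = _
  ... | just false | just ij = λ t → subst T ij t
  ... | nothing | _ = _

  module _ (ext : Extremal G) where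
    open Extremal ext

    vertexOK-sound : ∀ v → T (vertexOK P v)
    vertexOK-sound v = from T-∧ (≤⇒≤ᵇ outBound , from T-∧ (≤⇒≤ᵇ inBound , from T-∧ (≤⇒≤ᵇ sumBound , ≤⇒≤ᵇ adjBound)))
      where
      outBound : outDegree (Sure P) v ≤ 2
      outBound = ≤-trans (outDegree-mono Sure⊆arc v) (outDegree≤2 v)
      inBound : inDegree (Sure P) v ≤ 2
      inBound = ≤-trans (inDegree-mono Sure⊆arc v) (inDegree≤2 v)
      sumBound : outDegree (Sure P) v + inDegree (Sure P) v ≤ 3
      sumBound = ≤-trans (+-mono-≤ (outDegree-mono Sure⊆arc v) (inDegree-mono Sure⊆arc v)) (≤-reflexive (out+in≡3 v))
      adjBound : 3 ≤ adjDegree (Possible P) v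
      adjBound = ≤-trans (≤-reflexive (sym (trans (adjDegree≡out+in G v) (out+in≡3 v)))) (adjDegree-mono arc⊆Possible v)

    pairOK-sound : ∀ x y → T (pairOK P x y)
    pairOK-sound x y with x ≟ y
    ... | yes _ = _
    ... | no x≢y = from T-∧ (≤⇒≤ᵇ sureBound , ≤⇒≤ᵇ possibleBound)
      where
      sureBound : linkCount (Sure P) x y ≤ 1
      sureBound = ≤-trans (linkCount-mono Sure⊆arc x y) (≤-reflexive (uniquelyLinked x y x≢y))
      possibleBound : 1 ≤ linkCount (Possible P) x y
      possibleBound = ≤-trans (≤-reflexive (sym (uniquelyLinked x y x≢y))) (linkCount-mono arc⊆Possible x y)

    consistent-sound : ∀ i j → T (consistent P i j)
    consistent-sound i j = from T-∧ (vertexOK-sound i , from T-∧ (vertexOK-sound j ,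
      T-foldr-∧ λ y → from T-∧ (pairOK-sound i y , pairOK-sound j y)))

module _ {G : OrientedGraph 8} (ext : Extremal G) where

  refute-sound : ∀ ps {P} → P ⊑ G → refute P ps ≡ true → ⊥
  closes-sound : ∀ Q i j ps → Q ⊑ G → closes Q i j ps ≡ true → ⊥

  refute-sound [] _ ()
  refute-sound ((i , j) ∷ ps) {P} P⊑G refuted = branch (arc G i j) (arc G j i) refl refl
    where
    closes₁ closes₂ closes₃ : Bool
    closes₁ = closes (orient P i j false false) i j ps
    closes₂ = closes (orient P i j true false) i j ps
    closes₃ = closes (orient P i j false true) i j ps
    closes₂₃ : closes₂ ∧ closes₃ ≡ true
    closes₂₃ = ∧-conicalʳ closes₁ (closes₂ ∧ closes₃) refuted
    branch : ∀ a b → arc G i j ≡ a → arc G j i ≡ b → ⊥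
    branch false false ij ji = closes-sound _ i j ps (orient-⊑ P⊑G ij ji) (∧-conicalˡ closes₁ _ refuted)
    branch true  false ij ji = closes-sound _ i j ps (orient-⊑ P⊑G ij ji) (∧-conicalˡ closes₂ closes₃ closes₂₃)
    branch false true  ij ji = closes-sound _ i j ps (orient-⊑ P⊑G ij ji) (∧-conicalʳ closes₂ closes₃ closes₂₃)
    branch true  true  ij ji = digon-free G ij ji

  closes-sound Q i j ps Q⊑G closed =
    refute-sound ps Q⊑G (subst (λ c → not c ∨ refute Q ps ≡ true) (to T-≡ (consistent-sound Q⊑G ext i j)) closed)

start : Table
start = orient (orient (orient emptyTable 0F 1F true false) 0F 2F true false) 0F 3F false true

pairs : List (Fin 8 × Fin 8)
pairs = (0F , 4F) ∷ (0F , 5F) ∷ (0F , 6F) ∷ (0F , 7F) ∷ (1F , 2F) ∷ (1F , 3F) ∷ (1F , 4F) ∷ (1F , 5F) ∷ (1F , 6F) ∷ (1F , 7F) ∷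
        (2F , 3F) ∷ (2F , 4F) ∷ (2F , 5F) ∷ (2F , 6F) ∷ (2F , 7F) ∷ (3F , 4F) ∷ (3F , 5F) ∷ (3F , 6F) ∷ (3F , 7F) ∷
        (4F , 5F) ∷ (4F , 6F) ∷ (4F , 7F) ∷ (5F , 6F) ∷ (5F , 7F) ∷ (6F , 7F) ∷ []

-- Stated as an equation, this is decided by the fast conversion checker; elaborating
-- tt : T (refute start pairs) instead takes several times longer.
search-refutes : refute start pairs ≡ true
search-refutes = refl

start-⊑ : ∀ {G} → arc G 0F 1F ≡ true → arc G 0F 2F ≡ true → arc G 3F 0F ≡ true → start ⊑ G
start-⊑ {G} a01 a02 a30 =
  orient-⊑ {P = orient (orient emptyTable 0F 1F true false) 0F 2F true false}
    (orient-⊑ {P = orient emptyTable 0F 1F true false}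
      (orient-⊑ {P = emptyTable} (emptyTable-⊑ G) a01 (antisym G _ _ a01))
      a02 (antisym G _ _ a02))
    (antisym G _ _ a30) a30

extremal-not-normalised : ∀ {G} → Extremal G → arc G 0F 1F ≡ true → arc G 0F 2F ≡ true → arc G 3F 0F ≡ true → ⊥
extremal-not-normalised ext a01 a02 a30 =
  refute-sound ext pairs (start-⊑ a01 a02 a30) search-refutes

in1out2-impossible : (G : OrientedGraph 8) → Extremal G → inDegree (arc G) 0F ≡ 1 → outDegree (arc G) 0F ≡ 2 → ⊥
in1out2-impossible G ext in≡1 out≡2
  with count≥2⇒∃₂ (arc G 0F) (≤-reflexive (sym out≡2)) | count≥1⇒∃ (λ w → arc G w 0F) (≤-reflexive (sym in≡1))
... | a , b , a≢b , 0a , 0b | c , c0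
  with placing a b c (arc⇒≢ G 0a) (arc⇒≢ G 0b) (arc⇒≢ G c0 ∘ sym) a≢b
               (λ { refl → digon-free G 0a c0 }) (λ { refl → digon-free G 0b c0 })
... | σ , σ0≡0 , σ1≡a , σ2≡b , σ3≡c =
  extremal-not-normalised (relabel-extremal σ ext)
    (trans (cong₂ (arc G) σ0≡0 σ1≡a) 0a) (trans (cong₂ (arc G) σ0≡0 σ2≡b) 0b) (trans (cong₂ (arc G) σ3≡c σ0≡0) c0)

no-extremal-on-8 : (G : OrientedGraph 8) → Extremal G → ⊥
no-extremal-on-8 G ext with Extremal.split ext 0F
... | inj₁ (in≡1 , out≡2) = in1out2-impossible G ext in≡1 out≡2
... | inj₂ (in≡2 , out≡1) = in1out2-impossible (converse G) (converse-extremal ext) out≡1 in≡2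

-- An oriented clique on seven vertices

arc₇ : Fin 7 → Fin 7 → Bool
arc₇ 0F 5F = true
arc₇ 1F 3F = true
arc₇ 1F 4F = true
arc₇ 2F 3F = true
arc₇ 2F 6F = true
arc₇ 3F 6F = true
arc₇ 4F 2F = true
arc₇ 5F 1F = true
arc₇ 5F 4F = true
arc₇ 6F 0F = true
arc₇ _ _ = false

G₇ : OrientedGraph 7
G₇ = record
  { arc = arc₇
  ; irreflexive = toWitness {a? = all? λ u → arc₇ u u Bool.≟ false} _
  ; antisym = toWitness {a? = all? λ u → all? λ v → (arc₇ u v Bool.≟ true) →-dec (arc₇ v u Bool.≟ false)} _
  }

G₇-allLinked : AllLinked G₇
G₇-allLinked = toWitness {a? = all? λ u → all? λ x → ¬? (u ≟ x) →-dec linked? G₇ u x} _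

G₇-subcubic : MaxDegreeAtMost G₇ 3
G₇-subcubic = toWitness {a? = all? λ u → degree G₇ u ≤? 3} _

mainTheorem2 : Σ (OrientedGraph 7) (λ G → OrientedClique G × MaxDegreeAtMost G 3)
    × (∀ (n : ℕ) (G : OrientedGraph n) → OrientedClique G → MaxDegreeAtMost G 3 → n ≤ 7)
mainTheorem2 = (G₇ , allLinked⇒clique G₇ G₇-allLinked , G₇-subcubic) , upperBound
  where
  upperBound : ∀ (n : ℕ) (G : OrientedGraph n) → OrientedClique G → MaxDegreeAtMost G 3 → n ≤ 7
  upperBound n G clique subcubic with n ℕ.≟ 8 | clique⇒allLinked G clique
  ... | yes refl | linked = ⊥-elim (no-extremal-on-8 G (extremal G linked subcubic refl))
  ... | no n≢8   | linked = ≤-pred (≤∧≢⇒< (size≤8 G linked subcubic) n≢8)
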